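{- Let $(E,S,P)$ be a pmf-structure (as defined in the context). Then for all $x,y\in E$: (1) (probability upper bound) $P(x)\le 1$, i.e. $\mathbf{s}(\mathbf{s}(1-P(x))+1)=1$; (2) (joint probability factorization) $P(x,y)=P(x\mid y)\cdot P(y)$; (3) (Bayes' rule) $P(x\mid y)=\dfrac{P(y\mid x)\cdot P(x)}{P(y)}$.
   Context: Two-sorted signature: an event sort $E$ with binary operations $\vee,\wedge$, unary $\neg$, constants $\top,\bot$; a stalk sort $S$ with binary $+,\cdot$, unary $-$ (additive inverse), unary ${}^{ -1}$ (inverse), unary $\mathbf{s}$ (sign), constants $0,1$; and a function $P:E\to S$. Abbreviations: $p-q=p+(-q)$, $1_p=p\cdot p^{ -1}$, $0_p=1-1_p$, $\frac{p}{q}=p/q=p\cdot q^{ -1}$, $P(x,y)=P(x\wedge y)$, $P(x\mid y)=\frac{P(x,y)}{P(y)}$, and $p\le q$ means $\mathbf{s}(\mathbf{s}(q-p)+1)=1$. A pmf-structure is a structure for this signature satisfying, for all values of the variables, the following equations (APMF). Boolean algebra: $(x\vee y)\wedge y=y$; $(x\wedge y)\vee y=y$; $x\wedge(y\vee z)=(y\wedge x)\vee(z\wedge x)$; $x\vee(y\wedge z)=(y\vee x)\wedge(z\vee x)$; $x\wedge\neg x=\bot$; $x\vee\neg x=\top$. Meadow: $(x+y)+z=x+(y+z)$; $x+y=y+x$; $x+0=x$; $x+(-x)=0$; $(x\cdot y)\cdot z=x\cdot(y\cdot z)$; $x\cdot y=y\cdot x$; $1\cdot x=x$; $x\cdot(y+z)=x\cdot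 y+x\cdot z$; $(x^{ -1})^{ -1}=x$; $x\cdot(x\cdot x^{ -1})=x$. Sign: $\mathbf{s}(1_x)=1_x$; $\mathbf{s}(0_x)=0_x$; $\mathbf{s}(-1)=-1$; $\mathbf{s}(x^{ -1})=\mathbf{s}(x)$; $\mathbf{s}(x\cdot y)=\mathbf{s}(x)\cdot\mathbf{s}(y)$; $0_{\mathbf{s}(x)-\mathbf{s}(y)}\cdot(\mathbf{s}(x+y)-\mathbf{s}(x))=0$. Pmf (with $x,y$ events): $P(\top)=1$; $P(\bot)=0$; $\mathbf{s}(\mathbf{s}(P(x))+1)=1$; $P(x\vee y)=P(x)+P(y)-P(x\wedge y)$; $P(x\wedge y)\cdot P(y)\cdot P(y)^{ -1}=P(x\wedge y)$. -}

module Defs where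

open import Level using (Level; suc; _⊔_)
open import Relation.Binary.PropositionalEquality using (_≡_)

record PmfStructure (a b : Level) : Set (suc (a ⊔ b)) where
  infixr 6 _∨_
  infixr 7 _∧_
  infixl 6 _+_
  infixl 7 _·_
  field
    E    : Set a
    S    : Set b
    _∨_  : E → E → E
    _∧_  : E → E → E
    ¬_   : E → E
    ⊤    : E
    ⊥    : E
    _+_  : S → S → S
    _·_  : S → S → S
    -_   : S → S
    _⁻¹  : S → S
    sgn  : S → S
    0#   : S
    1#   : S
    P    : E → S

  _-_ : S → S → S
  p - q = p + (- q)

  1[_] : S → S
  1[ p ] = p · (p ⁻¹)

  0[_] : S → S
  0[ p ] = 1# - 1[ p ]

  _/_ : S → S → S
  p / q = p · (q ⁻¹)

  field
    ba-absorb₁ : ∀ x y → (x ∨ y) ∧ y ≡ y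
    ba-absorb₂ : ∀ x y → (x ∧ y) ∨ y ≡ y
    ba-distr₁  : ∀ x y z → x ∧ (y ∨ z) ≡ (y ∧ x) ∨ (z ∧ x)
    ba-distr₂  : ∀ x y z → x ∨ (y ∧ z) ≡ (y ∨ x) ∧ (z ∨ x)
    ba-compl₁  : ∀ x → x ∧ (¬ x) ≡ ⊥
    ba-compl₂  : ∀ x → x ∨ (¬ x) ≡ ⊤
    +-assoc  : ∀ x y z → (x + y) + z ≡ x + (y + z)
    +-comm   : ∀ x y → x + y ≡ y + x
    +-idʳ    : ∀ x → x + 0# ≡ x
    +-invʳ   : ∀ x → x + (- x) ≡ 0#
    ·-assoc  : ∀ x y z → (x · y) · z ≡ x · (y · z)
    ·-comm   : ∀ x y → x · y ≡ y · x
    ·-idˡ    : ∀ x → 1# · x ≡ x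
    distrib  : ∀ x y z → x · (y + z) ≡ x · y + x · z
    inv-invol : ∀ x → (x ⁻¹) ⁻¹ ≡ x
    ril      : ∀ x → x · (x · (x ⁻¹)) ≡ x
    sgn-1    : ∀ x → sgn 1[ x ] ≡ 1[ x ]
    sgn-0    : ∀ x → sgn 0[ x ] ≡ 0[ x ]
    sgn-m1   : sgn (- 1#) ≡ - 1#
    sgn-inv  : ∀ x → sgn (x ⁻¹) ≡ sgn x
    sgn-mul  : ∀ x y → sgn (x · y) ≡ sgn x · sgn y
    sgn-add  : ∀ x y → 0[ sgn x - sgn y ] · (sgn (x + y) - sgn x) ≡ 0#
    P-⊤      : P ⊤ ≡ 1#
    P-⊥      : P ⊥ ≡ 0#
    P-nonneg : ∀ x → sgn (sgn (P x) + 1#) ≡ 1#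
    P-or     : ∀ x y → P (x ∨ y) ≡ P x + P y - P (x ∧ y)
    P-cond   : ∀ x y → P (x ∧ y) · P y · (P y ⁻¹) ≡ P (x ∧ y)

  _≤_ : S → S → Set b
  p ≤ q = sgn (sgn (q - p) + 1#) ≡ 1#

  P₂ : E → E → S
  P₂ x y = P (x ∧ y)

  P[_∣_] : E → E → S
  P[ x ∣ y ] = P₂ x y / P y

-- Complementation turns the upper bound into the lower one: P(¬x) = 1 − P(x) by additivity
-- on x ∨ ¬x = ⊤, and P(¬x) ≥ 0 is an axiom. Factorisation is the axiom P(x,y)·P(y)·P(y)⁻¹ =
-- P(x,y) read through commutativity of the meadow product, and Bayes' rule follows from it
-- by the symmetry P(x,y) = P(y,x) of the Boolean meet.
module Submission where

open import Defs
open import Level using (Level)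
open import Data.Product using (_×_; _,_)
open import Relation.Binary.PropositionalEquality using (_≡_; sym; trans; cong; module ≡-Reasoning)

module PmfProperties {a b : Level} (M : PmfStructure a b) where
  open PmfStructure M
  open ≡-Reasoning

  ∨-idem : ∀ x → x ∨ x ≡ x
  ∨-idem x = begin
    x ∨ x             ≡⟨ cong (_∨ x) (sym (ba-absorb₁ x x)) ⟩
    (x ∨ x) ∧ x ∨ x   ≡⟨ ba-absorb₂ (x ∨ x) x ⟩
    x                 ∎

  ∧-comm : ∀ x y → x ∧ y ≡ y ∧ x
  ∧-comm x y = begin
    x ∧ y              ≡⟨ cong (x ∧_) (sym (∨-idem y)) ⟩
    x ∧ (y ∨ y)        ≡⟨ ba-distr₁ x y y ⟩
    y ∧ x ∨ y ∧ x      ≡⟨ ∨-idem (y ∧ x) ⟩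
    y ∧ x              ∎

  -0#≡0# : - 0# ≡ 0#
  -0#≡0# = begin
    - 0#          ≡⟨ sym (+-idʳ _) ⟩
    - 0# + 0#     ≡⟨ +-comm _ _ ⟩
    0# + - 0#     ≡⟨ +-invʳ 0# ⟩
    0#            ∎

  -- _-_ and _/_ carry no fixity declaration, so they bind tighter than _+_ and _·_.
  p+q-p≡q : ∀ p q → (p + q) - p ≡ q
  p+q-p≡q p q = begin
    p + q + - p      ≡⟨ cong (_+ - p) (+-comm p q) ⟩
    q + p + - p      ≡⟨ +-assoc q p (- p) ⟩
    q + (p + - p)    ≡⟨ cong (q +_) (+-invʳ p) ⟩
    q + 0#           ≡⟨ +-idʳ q ⟩
    q                ∎

  p/q·q≡p·q·q⁻¹ : ∀ p q → p / q · q ≡ p · q · q ⁻¹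
  p/q·q≡p·q·q⁻¹ p q = begin
    p · q ⁻¹ · q     ≡⟨ ·-assoc p (q ⁻¹) q ⟩
    p · (q ⁻¹ · q)   ≡⟨ cong (p ·_) (·-comm (q ⁻¹) q) ⟩
    p · (q · q ⁻¹)   ≡⟨ sym (·-assoc p q (q ⁻¹)) ⟩
    p · q · q ⁻¹     ∎

  P-x+P-¬x≡1 : ∀ x → P x + P (¬ x) ≡ 1#
  P-x+P-¬x≡1 x = begin
    P x + P (¬ x)                  ≡⟨ sym (cong (P x +_) (+-idʳ _)) ⟩
    P x + (P (¬ x) + 0#)           ≡⟨ sym (cong (λ t → P x + (P (¬ x) + t)) -0#≡0#) ⟩
    P x + (P (¬ x) - 0#)           ≡⟨ sym (cong (λ e → P x + (P (¬ x) - e)) (trans (cong P (ba-compl₁ x)) P-⊥)) ⟩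
    P x + (P (¬ x) - P (x ∧ ¬ x))  ≡⟨ sym (P-or x (¬ x)) ⟩
    P (x ∨ ¬ x)                    ≡⟨ cong P (ba-compl₂ x) ⟩
    P ⊤                            ≡⟨ P-⊤ ⟩
    1#                             ∎

  P-¬ : ∀ x → P (¬ x) ≡ 1# - P x
  P-¬ x = begin
    P (¬ x)                 ≡⟨ sym (p+q-p≡q (P x) (P (¬ x))) ⟩
    (P x + P (¬ x)) - P x   ≡⟨ cong (_- P x) (P-x+P-¬x≡1 x) ⟩
    1# - P x                ∎

  P≤1 : ∀ x → P x ≤ 1#
  P≤1 x = trans (cong (λ p → sgn (sgn p + 1#)) (sym (P-¬ x))) (P-nonneg (¬ x))

  P₂≡P[∣]·P : ∀ x y → P₂ x y ≡ P[ x ∣ y ] · P y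
  P₂≡P[∣]·P x y = sym (trans (p/q·q≡p·q·q⁻¹ (P₂ x y) (P y)) (P-cond x y))

  bayes : ∀ x y → P[ x ∣ y ] ≡ (P[ y ∣ x ] · P x) / P y
  bayes x y = cong (_/ P y) (trans (cong P (∧-comm x y)) (P₂≡P[∣]·P y x))

theorem1 : ∀ {a b : Level} (M : PmfStructure a b) → let open PmfStructure M in
    ∀ (x y : E) →
      (P x ≤ 1#)
      × (P₂ x y ≡ P[ x ∣ y ] · P y)
      × (P[ x ∣ y ] ≡ (P[ y ∣ x ] · P x) / P y)
theorem1 M x y = P≤1 x , P₂≡P[∣]·P x y , bayes x y
  where open PmfProperties M
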